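{- Let $\mathbf E=(E,+,{}',0,1)$ be an effect algebra with induced order $\leq$ satisfying the following two conditions for all $x,y\in E$ and all non-empty subsets $A$ of $E$: (1) if $A\leq y'$ and $x\in L(y+A)$, then there exist $z\in L(y)$ and $u\in L(A)$ with $z+u=x$; (2) if $A\leq y'$ and $x\in U(y+A)$, then there exist $z\in U(y)$ and $u\in U(A)$ with $z+u=x$. Then $\mathbf E$ is monotonous, i.e. for all $x\in E$ and all non-empty subsets $A,B$ of $E$, $A\cup B\leq x'$ and $L(A)\leq U(B)$ imply $L(x+A)\leq U(x+B)$.
   Context: An effect algebra is a partial algebra $(E,+,{}',0,1)$ of type $(2,1,0,0)$ where $(E,{}',0,1)$ is an algebra and $+$ is a partial binary operation such that for all $x,y,z\in E$: (E1) $x+y$ is defined iff $y+x$ is defined, and then $x+y=y+x$; (E2) $(x+y)+z$ is defined iff $x+(y+z)$ is defined, and then they are equal; (E3) $x'$ is the unique $u\in E$ with $x+u=1$; (E4) if $1+x$ is defined then $x=0$. The induced order is $x\leq y$ iff there is $z\in E$ with $x+z=y$. For a poset $(P,\leq)$, $A\subseteq P$ and $a\in P$: $L(A)=\{x\in P\mid x\leq y \text{ for all } y\in A\}$, $U(A)=\{x\in P\mid y\leq x\text{ for all }y\in A\}$, $L(a)=L(\{a\})$, $U(a)=U(\{a\})$. For subsets $A,B$, $A\leq B$ means $x\leq y$ for all $x\in A$, $y\in B$; $A\leq a$ means $A\leq\{a\}$. For $x\in E$ and $A\subseteq E$, $x+A=\{x+y\mid y\in A\}$. -}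

module Defs where

open import Level using (Level; _⊔_; suc; Lift)
open import Data.Product using (Σ; ∃; ∃-syntax; _×_; _,_)
open import Data.Sum using (_⊎_)
open import Relation.Binary.PropositionalEquality using (_≡_)

-- An effect algebra (E, +, ', 0, 1).  The partial binary operation + is
-- represented by its graph:  Sum x y z  means "x + y is defined and equals z".
record EffectAlgebra (c ℓ : Level) : Set (suc (c ⊔ ℓ)) where
  field
    Carrier : Set c
    Sum     : Carrier → Carrier → Carrier → Set ℓ
    _′      : Carrier → Carrier
    𝟘 𝟙     : Carrier
    Sum-functional : ∀ {x y z w} → Sum x y z → Sum x y w → z ≡ w
    E1 : ∀ {x y z} → Sum x y z → Sum y x z
    E2 : ∀ {x y z a b} → Sum x y a → Sum a z b → ∃[ c ] (Sum y z c × Sum x c b)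
    E2′ : ∀ {x y z c b} → Sum y z c → Sum x c b → ∃[ a ] (Sum x y a × Sum a z b)
    E3 : ∀ x → Sum x (x ′) 𝟙
    E3-unique : ∀ {x u} → Sum x u 𝟙 → u ≡ x ′
    E4 : ∀ {x z} → Sum 𝟙 x z → x ≡ 𝟘

module EffectAlgebraTheory {c ℓ : Level} (𝐄 : EffectAlgebra c ℓ) where
  open EffectAlgebra 𝐄 public

  Subset : Set (suc (c ⊔ ℓ))
  Subset = Carrier → Set (c ⊔ ℓ)

  NonEmpty : Subset → Set (c ⊔ ℓ)
  NonEmpty A = ∃[ a ] A a

  _≤_ : Carrier → Carrier → Set (c ⊔ ℓ)
  x ≤ y = ∃[ z ] Sum x z y

  _≤ˢ_ : Subset → Subset → Set (c ⊔ ℓ)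
  A ≤ˢ B = ∀ x y → A x → B y → x ≤ y

  _≤ᵉ_ : Subset → Carrier → Set (c ⊔ ℓ)
  A ≤ᵉ a = ∀ x → A x → x ≤ a

  L U : Subset → Subset
  L A x = ∀ y → A y → x ≤ y
  U A x = ∀ y → A y → y ≤ x

  ⟦_⟧ : Carrier → Subset
  ⟦ a ⟧ x = Lift (c ⊔ ℓ) (x ≡ a)

  Lₑ Uₑ : Carrier → Subset
  Lₑ a = L ⟦ a ⟧
  Uₑ a = U ⟦ a ⟧

  _+ˢ_ : Carrier → Subset → Subset
  (x +ˢ A) w = ∃[ y ] (A y × Sum x y w)

  _∪_ : Subset → Subset → Subset
  (A ∪ B) x = A x ⊎ B x

  Condition1 : Set (suc (c ⊔ ℓ))
  Condition1 = ∀ (x y : Carrier) (A : Subset) → NonEmpty A →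
    A ≤ᵉ (y ′) → L (y +ˢ A) x →
    ∃[ z ] ∃[ u ] (Lₑ y z × L A u × Sum z u x)

  Condition2 : Set (suc (c ⊔ ℓ))
  Condition2 = ∀ (x y : Carrier) (A : Subset) → NonEmpty A →
    A ≤ᵉ (y ′) → U (y +ˢ A) x →
    ∃[ z ] ∃[ u ] (Uₑ y z × U A u × Sum z u x)

  Monotonous : Set (suc (c ⊔ ℓ))
  Monotonous = ∀ (x : Carrier) (A B : Subset) → NonEmpty A → NonEmpty B →
    (A ∪ B) ≤ᵉ (x ′) → L A ≤ˢ U B → L (x +ˢ A) ≤ˢ U (x +ˢ B)

module Submission where

open import Level using (Level; lift)
open import Data.Product using (∃-syntax; _×_; _,_)
open import Data.Sum using (inj₁; inj₂)
open import Relation.Binary.PropositionalEquality using (refl; subst)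
open import Defs

-- Idea: an element p of L(x + A) splits as p = z + u with z ≤ x and u ∈ L(A)
-- by (1), and an element q of U(x + B) as q = z′ + v with x ≤ z′ and v ∈ U(B)
-- by (2).  Then z ≤ z′ and u ≤ v, and addition is monotone, so p ≤ q.

module EffectAlgebraOrder {c ℓ : Level} (𝐄 : EffectAlgebra c ℓ) where
  open EffectAlgebraTheory 𝐄

  ≤-trans : ∀ {x y w} → x ≤ y → y ≤ w → x ≤ w
  ≤-trans (a , x+a=y) (b , y+b=w) with E2 x+a=y y+b=w
  ... | (c , _ , x+c=w) = c , x+c=w

  +-monoˡ-≤ : ∀ {a b d s} → a ≤ b → Sum b d s → ∃[ t ] (Sum a d t × t ≤ s)
  +-monoˡ-≤ (e , a+e=b) b+d=s with E2 a+e=b b+d=s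
  ... | (c , e+d=c , a+c=s) with E2′ (E1 e+d=c) a+c=s
  ... | (r , a+d=r , r+e=s) = r , a+d=r , (e , r+e=s)

  +-mono-≤ : ∀ {a b d e s t} → a ≤ b → d ≤ e → Sum a d s → Sum b e t → s ≤ t
  +-mono-≤ a≤b d≤e a+d=s b+e=t with +-monoˡ-≤ a≤b b+e=t
  ... | (r , a+e=r , r≤t) with +-monoˡ-≤ d≤e (E1 a+e=r)
  ... | (r′ , d+a=r′ , r′≤r) =
    ≤-trans (subst (_≤ _) (Sum-functional (E1 d+a=r′) a+d=s) r′≤r) r≤t

  condition1∧condition2⇒monotonous : Condition1 → Condition2 → Monotonous
  condition1∧condition2⇒monotonous cond1 cond2 x A B neA neB A∪B≤x′ LA≤UB p q p∈L[x+A] q∈U[x+B]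
    with cond1 p x A neA (λ y y∈A → A∪B≤x′ y (inj₁ y∈A)) p∈L[x+A]
       | cond2 q x B neB (λ y y∈B → A∪B≤x′ y (inj₂ y∈B)) q∈U[x+B]
  ... | (z , u , z≤x , u∈LA , z+u=p) | (z′ , v , x≤z′ , v∈UB , z′+v=q) =
    +-mono-≤ (≤-trans (z≤x x (lift refl)) (x≤z′ x (lift refl)))
             (LA≤UB u v u∈LA v∈UB) z+u=p z′+v=q

lemma3 : {c ℓ : Level} (𝐄 : EffectAlgebra c ℓ) →
    EffectAlgebraTheory.Condition1 𝐄 → EffectAlgebraTheory.Condition2 𝐄 →
    EffectAlgebraTheory.Monotonous 𝐄
lemma3 𝐄 = EffectAlgebraOrder.condition1∧condition2⇒monotonous 𝐄
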